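{- Let $n\ge0$ and let $\pi$ be an up-down permutation of $[n+1]$. Then the number of cycles of $\psi(\pi)$ equals $\mathrm{extr}(\pi)$, the number of extreme elements of $\pi$.
   Context: An up-down permutation of $[n+1]$ is $\pi_1\cdots\pi_{n+1}$ with $\pi_1<\pi_2>\pi_3<\cdots$. In a word $w_1\cdots w_r$ of distinct integers, $w_i$ is a left-to-right (LR) minimum (resp. maximum) if $w_i<w_j$ (resp. $w_i>w_j$) for all $j<i$; for $i\ge2$, $w_i$ is an extreme element if it is an LR minimum or an LR maximum; $\mathrm{extr}(w)$ is the number of extreme elements (positions $i\ge2$ only). For a word $w$ whose set of entries is $\{a_1<\dots<a_r\}$, its switch $\overline{w}$ replaces each $a_i$ by $a_{r+1-i}$. The map $\psi$ is defined as follows. Start with $\tau=\pi$. While $\tau$ has at least two entries: let $\tau_j$ be the rightmost extreme element of the current word $\tau=\tau_1\cdots\tau_r$; if it is an LR maximum, replace $\tau$ by $\overline{\tau}$ (so that the entry at position $j$ becomes an LR minimum); then add the cycle $(\tau_j,\tau_{j+1},\dots,\tau_r)$ to $\psi(\pi)$ and delete the entries $\tau_j\cdots\tau_r$ from $\tau$. When $\tau$ has one entry, stop. $\psi(\pi)$ is the permutation of $[n]$ given by the product of the collected disjoint cycles. -}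

module Defs where

open import Data.Bool using (Bool; true; false; _∧_; _∨_; not; if_then_else_)
open import Data.Nat using (ℕ; zero; suc; _<_; _≤_; _<ᵇ_; _≡ᵇ_)
open import Data.Nat.Properties using (_<?_; _≤?_; _≟_)
open import Data.List using (List; []; _∷_; length; map; filter; upTo; take; drop; _++_; [_])
open import Data.List.Relation.Unary.All using (All; all?)
open import Data.Maybe using (Maybe; just; nothing)
open import Data.Product using (_×_; _,_)
open import Data.Unit using (⊤)
open import Relation.Nullary.Decidable using (⌊_⌋)

Alternating : Bool → List ℕ → Set
Alternating up (x ∷ y ∷ rest) =
  (if up then x < y else y < x) × Alternating (not up) (y ∷ rest)
Alternating up _ = ⊤

UpDown : List ℕ → Set
UpDown = Alternating true

isLRMin : List ℕ → ℕ → Bool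
isLRMin pre x = ⌊ all? (λ y → x <? y) pre ⌋

isLRMax : List ℕ → ℕ → Bool
isLRMax pre x = ⌊ all? (λ y → y <? x) pre ⌋

-- Extreme positions (0-based index i ≥ 1, i.e. 1-based position ≥ 2),
-- each tagged with whether the element there is an LR maximum (and not an LR minimum).
extremesGo : ℕ → List ℕ → List ℕ → List (ℕ × Bool)
extremesGo i pre [] = []
extremesGo i pre (x ∷ xs) =
  let rest = extremesGo (suc i) (pre ++ [ x ]) xs in
  if isLRMin pre x then (i , false) ∷ rest
  else if isLRMax pre x then (i , true) ∷ rest
  else rest

extremes : List ℕ → List (ℕ × Bool)
extremes [] = []
extremes (x ∷ xs) = extremesGo 1 [ x ] xs

extr : List ℕ → ℕ
extr w = length (extremes w)

lastMaybe : {A : Set} → List A → Maybe A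
lastMaybe [] = nothing
lastMaybe (x ∷ []) = just x
lastMaybe (x ∷ y ∷ ys) = lastMaybe (y ∷ ys)

-- Switch: entries a₁ < ⋯ < a_r; a_i ↦ a_{r+1-i}.
-- a_i is the entry with exactly i-1 entries below it; a_{r+1-i} is the entry
-- with exactly i-1 entries above it.
countBelow : List ℕ → ℕ → ℕ
countBelow w x = length (filter (λ y → y <? x) w)

countAbove : List ℕ → ℕ → ℕ
countAbove w x = length (filter (λ y → x <? y) w)

headOr : ℕ → List ℕ → ℕ
headOr d [] = d
headOr d (y ∷ _) = y

switchEntry : List ℕ → ℕ → ℕ
switchEntry w x = headOr x (filter (λ y → countAbove w y ≟ countBelow w x) w)

switch : List ℕ → List ℕ
switch w = map (switchEntry w) w

-- The map ψ, as the list of collected cycles (fuel = number of steps allowed;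
-- each step removes at least one entry, so fuel = length suffices).
psiGo : ℕ → List ℕ → List (List ℕ)
psiGo zero τ = []
psiGo (suc k) τ with lastMaybe (extremes τ)
... | nothing = []
... | just (j , isMax) =
  let τ' = if isMax then switch τ else τ in
  drop j τ' ∷ psiGo k (take j τ')

psiCycles : List ℕ → List (List ℕ)
psiCycles π = psiGo (length π) π

-- Applying a cycle (c₀ c₁ ⋯ c_m) : c_k ↦ c_{k+1}, c_m ↦ c₀; identity off the cycle.
applyCycleGo : ℕ → List ℕ → ℕ → ℕ
applyCycleGo c₀ [] x = x
applyCycleGo c₀ (c ∷ []) x = if c ≡ᵇ x then c₀ else x
applyCycleGo c₀ (c ∷ d ∷ cs) x = if c ≡ᵇ x then d else applyCycleGo c₀ (d ∷ cs) x

applyCycle : List ℕ → ℕ → ℕ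
applyCycle [] x = x
applyCycle (c ∷ cs) x = applyCycleGo c (c ∷ cs) x

applyCycles : List (List ℕ) → ℕ → ℕ
applyCycles [] x = x
applyCycles (c ∷ cs) x = applyCycle c (applyCycles cs x)

psi : List ℕ → ℕ → ℕ
psi π = applyCycles (psiCycles π)

iter : (ℕ → ℕ) → ℕ → ℕ → ℕ
iter σ zero x = x
iter σ (suc k) x = σ (iter σ k x)

-- i is the smallest element of its σ-orbit (orbits in [n] have size ≤ n)
isOrbitMin : ℕ → (ℕ → ℕ) → ℕ → Bool
isOrbitMin n σ i = ⌊ all? (λ k → i ≤? iter σ k i) (upTo (suc n)) ⌋

-- Number of cycles of a permutation σ of [n] = {1,…,n}
-- (= number of orbits, each counted by its minimum; fixed points included).
numCycles : ℕ → (ℕ → ℕ) → ℕ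
numCycles n σ = length (filter (λ i → Data.Bool._≟_ (isOrbitMin n σ i) true) (map suc (upTo n)))

module Submission where

-- Each round of ψ cuts the current word τ at its rightmost extreme element (after
-- switching τ if that element is an LR maximum) and turns the cut-off suffix into a cycle.
-- The invariant PsiInvariant says: the cycles collected from τ are nonempty, one per
-- extreme element of τ, and they list all entries of τ except one leftover entry that
-- bounds τ from above.  Its inductive step (invariant-cut, psiInvariant) rests on:
--   * switching is an order-reversing bijection of the entries, so it permutes the word
--     and exchanges LR minima with LR maxima (switch-↭, switch-extremes);
--   * cutting at the last extreme removes exactly that extreme, and after a final LR
--     minimum nothing exceeds the earlier entries (LastExtreme, lastExtreme).
-- For π the leftover is n+1, so the cycles list {1,…,n}; and a product of disjoint
-- nonempty cycles listing {1,…,n} has exactly one orbit minimum per cycle, namely the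
-- least entry of that cycle (numCycles-applyCycles).

open import Defs
open import Data.Bool using (Bool; true; false; not; if_then_else_)
import Data.Bool as Bool
open import Data.Bool.Properties using (T-≡)
open import Data.Nat using (ℕ; zero; suc; _+_; _<_; _≤_; z≤n; s≤s; _≡ᵇ_)
open import Data.Nat.Properties
open import Data.List using (List; []; _∷_; length; map; filter; upTo; take; drop; _++_; [_]; concat)
open import Data.List.Properties
  using (length-++; length-map; length-upTo; length-filter; ++-assoc; ++-identityʳ; map-++; upTo-∷ʳ;
         filter-++; filter-accept; filter-reject; filter-all; ∷-injective)
open import Data.List.Relation.Unary.All as All using (All; []; _∷_)
import Data.List.Relation.Unary.All.Properties as All
open import Data.List.Relation.Unary.AllPairs using ([]; _∷_)
open import Data.List.Relation.Unary.Any using (here; there)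
open import Data.List.Relation.Unary.Unique.Propositional using (Unique)
import Data.List.Relation.Unary.Unique.Propositional.Properties as Unique
open import Data.List.Membership.Propositional using (_∈_; _∉_)
open import Data.List.Membership.Propositional.Properties
  using (∈-++⁺ˡ; ∈-++⁺ʳ; ∈-++⁻; ∈-∃++; ∈-concat⁺′; ∈-map⁺; ∈-map⁻; ∈-upTo⁺; ∈-upTo⁻; ∈-filter⁻; ∈-filter⁺)
open import Data.List.Relation.Binary.Permutation.Propositional
  using (_↭_; ↭-refl; ↭-sym; ↭-trans; prep; ↭⇒↭ₛ; module PermutationReasoning)
open import Data.List.Relation.Binary.Permutation.Propositional.Properties
  using (↭-length; filter-↭; shift; ++⁺ˡ; ++-comm; All-resp-↭; ∈-resp-↭; drop-mid)
import Data.List.Relation.Binary.Permutation.Setoid.Properties as PermSetoid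
import Data.List.Extrema.Nat as Extrema
open import Data.Maybe using (just; nothing)
import Data.Maybe as Maybe
open import Data.Product using (Σ; _×_; _,_; proj₁; proj₂)
open import Data.Sum using (_⊎_; inj₁; inj₂)
open import Data.Empty using (⊥; ⊥-elim)
open import Data.Unit using (tt)
open import Function using (_∘_; _⇔_; mk⇔)
open import Function.Bundles using (module Equivalence)
open import Relation.Nullary using (¬_; Dec; yes; no)
open import Relation.Nullary.Decidable using (isYes; isYes≗does; dec-true; dec-false; does-⇔; toWitness)
open import Relation.Binary using (tri<; tri≈; tri>)
open import Relation.Binary.PropositionalEquality
  using (_≡_; _≢_; refl; sym; trans; cong; cong₂; subst; subst₂; setoid; module ≡-Reasoning)

isYes⇒ : ∀ {p} {P : Set p} (d : Dec P) → isYes d ≡ true → P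
isYes⇒ d e = toWitness {a? = d} (Equivalence.from T-≡ e)

⇒isYes : ∀ {p} {P : Set p} (d : Dec P) → P → isYes d ≡ true
⇒isYes d p = trans (isYes≗does d) (dec-true d p)

isYes-false⇒¬ : ∀ {p} {P : Set p} (d : Dec P) → isYes d ≡ false → ¬ P
isYes-false⇒¬ d isNo p with () ← trans (sym isNo) (⇒isYes d p)

isYes-⇔ : ∀ {p q} {P : Set p} {Q : Set q} → P ⇔ Q → (d : Dec P) (e : Dec Q) → isYes d ≡ isYes e
isYes-⇔ P⇔Q d e = trans (isYes≗does d) (trans (does-⇔ P⇔Q d e) (sym (isYes≗does e)))

unique-resp-↭ : ∀ {xs ys : List ℕ} → xs ↭ ys → Unique xs → Unique ys
unique-resp-↭ p = PermSetoid.Unique-resp-↭ (setoid ℕ) (↭⇒↭ₛ p)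

unique-++ˡ : ∀ (xs : List ℕ) {ys} → Unique (xs ++ ys) → Unique xs
unique-++ˡ [] u = []
unique-++ˡ (x ∷ xs) (x∉ ∷ u) = All.++⁻ˡ xs x∉ ∷ unique-++ˡ xs u

unique-++ʳ : ∀ (xs : List ℕ) {ys} → Unique (xs ++ ys) → Unique ys
unique-++ʳ [] u = u
unique-++ʳ (x ∷ xs) (_ ∷ u) = unique-++ʳ xs u

unique-++-disjoint : ∀ (xs : List ℕ) {ys x y} → Unique (xs ++ ys) → x ∈ xs → y ∈ ys → x ≢ y
unique-++-disjoint (a ∷ xs) (a∉ ∷ u) (here refl) y∈ = All.lookup a∉ (∈-++⁺ʳ xs y∈)
unique-++-disjoint (a ∷ xs) (_ ∷ u) (there x∈) y∈ = unique-++-disjoint xs u x∈ y∈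

unique-mid : ∀ (u : List ℕ) {x v} → Unique (u ++ x ∷ v) → x ∉ u
unique-mid u un x∈u = unique-++-disjoint u un x∈u (here refl) refl

unique-constant-length : ∀ {m} (l : List ℕ) → Unique l → All (_≡ m) l → m ∈ l → length l ≡ 1
unique-constant-length (x ∷ []) _ _ _ = refl
unique-constant-length (x ∷ y ∷ l) ((x≢y ∷ _) ∷ _) (refl ∷ refl ∷ _) _ = ⊥-elim (x≢y refl)

count-unique-witness : ∀ {P : ℕ → Set} (P? : ∀ x → Dec (P x)) {m} (l : List ℕ) → Unique l →
  m ∈ l → P m → (∀ {x} → x ∈ l → P x → x ≡ m) → length (filter P? l) ≡ 1
count-unique-witness P? l un m∈ pm only =
  unique-constant-length (filter P? l) (Unique.filter⁺ P? un)
    (All.tabulate λ x∈ → let x∈l , px = ∈-filter⁻ P? x∈ in only x∈l px)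
    (∈-filter⁺ P? m∈ pm)

least : ∀ (c : List ℕ) → c ≢ [] → Σ ℕ λ m → m ∈ c × All (m ≤_) c
least [] c≢[] = ⊥-elim (c≢[] refl)
least (a ∷ l) _ = Extrema.min a l , member (Extrema.argmin-sel (λ x → x) a l) , Extrema.min≤⊤ a l ∷ Extrema.min≤xs a l
  where
  member : ∀ {m} → m ≡ a ⊎ m ∈ l → m ∈ a ∷ l
  member (inj₁ refl) = here refl
  member (inj₂ m∈) = there m∈

<-length-++-∷ : ∀ (v : List ℕ) {y} w → length v < length (v ++ y ∷ w)
<-length-++-∷ [] w = s≤s z≤n
<-length-++-∷ (_ ∷ v) w = s≤s (<-length-++-∷ v w)

≤-length-++ʳ : ∀ (u : List ℕ) {w} → length w ≤ length (u ++ w)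
≤-length-++ʳ u {w} = subst (length w ≤_) (sym (length-++ u)) (m≤n+m (length w) (length u))

-- Cycles.  applyCycleGo a L sends an entry x of L to its successor in L ++ [ a ];
-- applyCycle (a ∷ l) is therefore the cyclic permutation a ↦ ⋯ ↦ last ↦ a.
private
  ≡ᵇ-refl : ∀ x → (x ≡ᵇ x) ≡ true
  ≡ᵇ-refl x = dec-true (x ≟ x) refl

  ≢⇒≡ᵇ-false : ∀ {c x} → c ≢ x → (c ≡ᵇ x) ≡ false
  ≢⇒≡ᵇ-false {c} {x} = dec-false (c ≟ x)

cycleGo-skip : ∀ a c r x → c ≢ x → applyCycleGo a (c ∷ r) x ≡ applyCycleGo a r x
cycleGo-skip a c [] x c≢x rewrite ≢⇒≡ᵇ-false c≢x = refl
cycleGo-skip a c (d ∷ r) x c≢x rewrite ≢⇒≡ᵇ-false c≢x = refl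

cycleGo-successor : ∀ a u x v → x ∉ u → applyCycleGo a (u ++ x ∷ v) x ≡ headOr a v
cycleGo-successor a [] x [] _ rewrite ≡ᵇ-refl x = refl
cycleGo-successor a [] x (y ∷ v) _ rewrite ≡ᵇ-refl x = refl
cycleGo-successor a (c ∷ u) x v x∉ =
  trans (cycleGo-skip a c (u ++ x ∷ v) x (x∉ ∘ here ∘ sym)) (cycleGo-successor a u x v (x∉ ∘ there))

cycleGo-fixes : ∀ a l y → y ∉ l → applyCycleGo a l y ≡ y
cycleGo-fixes a [] y _ = refl
cycleGo-fixes a (c ∷ l) y y∉ = trans (cycleGo-skip a c l y (y∉ ∘ here ∘ sym)) (cycleGo-fixes a l y (y∉ ∘ there))

applyCycle-fixes : ∀ c y → y ∉ c → applyCycle c y ≡ y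
applyCycle-fixes [] y _ = refl
applyCycle-fixes (a ∷ l) y = cycleGo-fixes a (a ∷ l) y

applyCycle-closed : ∀ c {x} → Unique c → x ∈ c → applyCycle c x ∈ c
applyCycle-closed (a ∷ l) {x} un x∈ with ∈-∃++ x∈
... | u , v , c≡ = subst (_∈ a ∷ l) (sym successor) (next∈ v c≡)
  where
  successor : applyCycleGo a (a ∷ l) x ≡ headOr a v
  successor = subst (λ L → applyCycleGo a L x ≡ headOr a v) (sym c≡)
    (cycleGo-successor a u x v (unique-mid u (subst Unique c≡ un)))
  next∈ : ∀ w → a ∷ l ≡ u ++ x ∷ w → headOr a w ∈ a ∷ l
  next∈ [] _ = here refl
  next∈ (y ∷ w) e = subst (y ∈_) (sym e) (∈-++⁺ʳ u (there (here refl)))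

iter-suc : ∀ σ k x → iter σ (suc k) x ≡ iter σ k (σ x)
iter-suc σ zero x = refl
iter-suc σ (suc k) x = cong σ (iter-suc σ k x)

iter-+ : ∀ σ k j x → iter σ (k + j) x ≡ iter σ k (iter σ j x)
iter-+ σ zero j x = refl
iter-+ σ (suc k) j x = cong σ (iter-+ σ k j x)

iter-closed : ∀ σ (c : List ℕ) → (∀ {x} → x ∈ c → σ x ∈ c) → ∀ k {x} → x ∈ c → iter σ k x ∈ c
iter-closed σ c closed zero x∈ = x∈
iter-closed σ c closed (suc k) x∈ = closed (iter-closed σ c closed k x∈)

iter-agree : ∀ σ τ (c : List ℕ) → (∀ {x} → x ∈ c → σ x ≡ τ x) → (∀ {x} → x ∈ c → τ x ∈ c) →
  ∀ k {x} → x ∈ c → iter σ k x ≡ iter τ k x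
iter-agree σ τ c agree closed zero x∈ = refl
iter-agree σ τ c agree closed (suc k) x∈ =
  trans (cong σ (iter-agree σ τ c agree closed k x∈)) (agree (iter-closed τ c closed k x∈))

cycleGo-walk : ∀ a L u x v w → L ≡ u ++ x ∷ v ++ w → Unique L →
  iter (applyCycleGo a L) (length (x ∷ v)) x ≡ headOr a w
cycleGo-walk a L u x [] w refl un = cycleGo-successor a u x w (unique-mid u un)
cycleGo-walk a L u x (z ∷ v) w L≡ un = begin
  iter σ (suc (length (z ∷ v))) x  ≡⟨ iter-suc σ (length (z ∷ v)) x ⟩
  iter σ (length (z ∷ v)) (σ x)    ≡⟨ cong (iter σ (length (z ∷ v))) step ⟩
  iter σ (length (z ∷ v)) z        ≡⟨ cycleGo-walk a L (u ++ [ x ]) z v w (trans L≡ (sym (++-assoc u [ x ] _))) un ⟩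
  headOr a w                       ∎
  where
  open ≡-Reasoning
  σ : ℕ → ℕ
  σ = applyCycleGo a L
  step : σ x ≡ z
  step = subst (λ L′ → applyCycleGo a L′ x ≡ z) (sym L≡)
    (cycleGo-successor a u x (z ∷ v ++ w) (unique-mid u (subst Unique L≡ un)))

cycle-reach : ∀ c {x y} → Unique c → x ∈ c → y ∈ c →
  Σ ℕ λ k → k < length c × iter (applyCycle c) k x ≡ y
cycle-reach (a ∷ l) {x} {y} un x∈ y∈ with ∈-∃++ x∈
... | u , v , c≡ with ∈-++⁻ u (subst (y ∈_) c≡ y∈)
... | inj₂ (here refl) = 0 , s≤s z≤n , refl
... | inj₂ (there y∈v) with ∈-∃++ y∈v
...   | v₁ , v₂ , refl =
  length (x ∷ v₁) ,
  subst (length (x ∷ v₁) <_) (cong length (sym c≡)) (≤-trans (s≤s (<-length-++-∷ v₁ v₂)) (≤-length-++ʳ u)) ,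
  cycleGo-walk a (a ∷ l) u x v₁ (y ∷ v₂) c≡ un
cycle-reach (a ∷ l) {x} {y} un x∈ y∈ | u , v , c≡ | inj₁ y∈u with ∈-∃++ y∈u
... | u₁ , u₂ , refl = length u₁ + length (x ∷ v) , bound , (begin
  iter σ (length u₁ + length (x ∷ v)) x  ≡⟨ iter-+ σ (length u₁) (length (x ∷ v)) x ⟩
  iter σ (length u₁) (iter σ (length (x ∷ v)) x)
    ≡⟨ cong (iter σ (length u₁)) (cycleGo-walk a (a ∷ l) (u₁ ++ y ∷ u₂) x v [] c≡′ un) ⟩
  iter σ (length u₁) a                    ≡⟨ fromHead u₁ (trans c≡ (++-assoc u₁ (y ∷ u₂) (x ∷ v))) ⟩
  y                                       ∎)
  where
  open ≡-Reasoning
  σ : ℕ → ℕ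
  σ = applyCycle (a ∷ l)
  c≡′ : a ∷ l ≡ (u₁ ++ y ∷ u₂) ++ x ∷ v ++ []
  c≡′ = trans c≡ (cong (λ t → (u₁ ++ y ∷ u₂) ++ x ∷ t) (sym (++-identityʳ v)))
  fromHead : ∀ w → a ∷ l ≡ w ++ y ∷ (u₂ ++ x ∷ v) → iter σ (length w) a ≡ y
  fromHead [] e = proj₁ (∷-injective e)
  fromHead (b ∷ w) e with ∷-injective e
  ... | refl , e′ = cycleGo-walk a (a ∷ l) [] a w (y ∷ u₂ ++ x ∷ v) (cong (a ∷_) e′) un
  bound : length u₁ + length (x ∷ v) < length (a ∷ l)
  bound = subst (length u₁ + length (x ∷ v) <_) (cong length (sym c≡))
    (subst (length u₁ + length (x ∷ v) <_)
      (sym (trans (length-++ (u₁ ++ y ∷ u₂)) (cong (_+ length (x ∷ v)) (length-++ u₁))))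
      (+-monoˡ-< (length (x ∷ v)) (m<m+n (length u₁) (s≤s z≤n))))

applyCycles-outside : ∀ cs {x} → x ∉ concat cs → applyCycles cs x ≡ x
applyCycles-outside [] _ = refl
applyCycles-outside (d ∷ cs) {x} x∉ =
  trans (cong (applyCycle d) (applyCycles-outside cs (x∉ ∘ ∈-++⁺ʳ d))) (applyCycle-fixes d x (x∉ ∘ ∈-++⁺ˡ))

unique-concat : ∀ {cs : List (List ℕ)} {c} → Unique (concat cs) → c ∈ cs → Unique c
unique-concat {d ∷ cs} un (here refl) = unique-++ˡ d un
unique-concat {d ∷ cs} un (there c∈) = unique-concat (unique-++ʳ d un) c∈

length-concat : ∀ {cs : List (List ℕ)} {c} → c ∈ cs → length c ≤ length (concat cs)
length-concat {d ∷ cs} (here refl) = subst (length d ≤_) (sym (length-++ d)) (m≤m+n _ _)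
length-concat {d ∷ cs} (there c∈) = ≤-trans (length-concat c∈) (≤-length-++ʳ d)

applyCycles-on : ∀ cs {c x} → Unique (concat cs) → c ∈ cs → x ∈ c → applyCycles cs x ≡ applyCycle c x
applyCycles-on (d ∷ cs) {x = x} un (here refl) x∈ =
  cong (applyCycle d) (applyCycles-outside cs λ x∈cs → unique-++-disjoint d un x∈ x∈cs refl)
applyCycles-on (d ∷ cs) {c} {x} un (there c∈) x∈ =
  trans (cong (applyCycle d) (applyCycles-on cs (unique-++ʳ d un) c∈ x∈))
        (applyCycle-fixes d _ λ y∈d → unique-++-disjoint d un y∈d
           (∈-concat⁺′ (applyCycle-closed c (unique-concat (unique-++ʳ d un) c∈) x∈) c∈) refl)

OrbitMin : ℕ → (ℕ → ℕ) → ℕ → Set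
OrbitMin n σ i = isOrbitMin n σ i ≡ true

orbitMin? : ∀ n σ i → Dec (OrbitMin n σ i)
orbitMin? n σ i = isOrbitMin n σ i Bool.≟ true

count-concat : ∀ {P : ℕ → Set} (P? : ∀ x → Dec (P x)) (ds : List (List ℕ)) →
  All (λ d → length (filter P? d) ≡ 1) ds → length (filter P? (concat ds)) ≡ length ds
count-concat P? [] [] = refl
count-concat P? (d ∷ ds) (one ∷ ones) = begin
  length (filter P? (d ++ concat ds))              ≡⟨ cong length (filter-++ P? d (concat ds)) ⟩
  length (filter P? d ++ filter P? (concat ds))    ≡⟨ length-++ (filter P? d) ⟩
  length (filter P? d) + length (filter P? (concat ds)) ≡⟨ cong₂ _+_ one (count-concat P? ds ones) ⟩
  suc (length ds)                                  ∎
  where open ≡-Reasoning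

module CycleProduct (n : ℕ) (cs : List (List ℕ)) (un : Unique (concat cs)) (small : length (concat cs) ≤ n) where

  σ : ℕ → ℕ
  σ = applyCycles cs

  module _ {c} (c∈ : c ∈ cs) where

    private
      uc : Unique c
      uc = unique-concat un c∈

      iter-on-cycle : ∀ k {x} → x ∈ c → iter σ k x ≡ iter (applyCycle c) k x
      iter-on-cycle = iter-agree σ (applyCycle c) c (applyCycles-on cs un c∈) (applyCycle-closed c uc)

    orbitMin⇒least : ∀ {x} → x ∈ c → OrbitMin n σ x → All (x ≤_) c
    orbitMin⇒least {x} x∈ om = All.tabulate λ y∈ →
      let k , k< , reaches = cycle-reach c uc x∈ y∈
          k≤n = ≤-trans k< (m≤n⇒m≤1+n (≤-trans (length-concat c∈) small))
      in subst (x ≤_) (trans (iter-on-cycle k x∈) reaches)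
           (All.lookup (isYes⇒ (All.all? _ _) om) (∈-upTo⁺ k≤n))

    least⇒orbitMin : ∀ {x} → x ∈ c → All (x ≤_) c → OrbitMin n σ x
    least⇒orbitMin {x} x∈ x≤c = ⇒isYes (All.all? _ _) (All.tabulate λ {k} _ →
      All.lookup x≤c (subst (_∈ c) (sym (iter-on-cycle k x∈)) (iter-closed _ c (applyCycle-closed c uc) k x∈)))

    one-orbitMin : c ≢ [] → length (filter (orbitMin? n σ) c) ≡ 1
    one-orbitMin c≢[] =
      let m , m∈ , m≤c = least c c≢[] in
      count-unique-witness (orbitMin? n σ) c uc m∈ (least⇒orbitMin m∈ m≤c)
        λ x∈ om → ≤-antisym (All.lookup (orbitMin⇒least x∈ om) m∈) (All.lookup m≤c x∈)

numCycles-applyCycles : ∀ n cs → All (_≢ []) cs → concat cs ↭ map suc (upTo n) →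
  numCycles n (applyCycles cs) ≡ length cs
numCycles-applyCycles n cs nonEmpty p = begin
  numCycles n σ                                ≡⟨ ↭-length (filter-↭ (orbitMin? n σ) (↭-sym p)) ⟩
  length (filter (orbitMin? n σ) (concat cs))  ≡⟨ count-concat (orbitMin? n σ) cs
                                                    (All.tabulate λ c∈ → one-orbitMin c∈ (All.lookup nonEmpty c∈)) ⟩
  length cs                                    ∎
  where
  open ≡-Reasoning
  un : Unique (concat cs)
  un = unique-resp-↭ (↭-sym p) (Unique.map⁺ suc-injective (Unique.upTo⁺ n))
  small : length (concat cs) ≤ n
  small = ≤-reflexive (trans (↭-length p) (trans (length-map suc (upTo n)) (length-upTo n)))
  open CycleProduct n cs un small

module _ {P Q : ℕ → Set} (P? : ∀ x → Dec (P x)) (Q? : ∀ x → Dec (Q x)) (P⇒Q : ∀ {z} → P z → Q z) where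

  filter-length-mono : ∀ l → length (filter P? l) ≤ length (filter Q? l)
  filter-length-mono [] = z≤n
  filter-length-mono (a ∷ l) with P? a | Q? a
  ... | yes _  | yes _  = s≤s (filter-length-mono l)
  ... | yes pa | no ¬qa = ⊥-elim (¬qa (P⇒Q pa))
  ... | no _   | yes _  = m≤n⇒m≤1+n (filter-length-mono l)
  ... | no _   | no _   = filter-length-mono l

  filter-length-strict : ∀ l {w} → w ∈ l → Q w → ¬ P w → length (filter P? l) < length (filter Q? l)
  filter-length-strict (a ∷ l) (here refl) qw ¬pw with P? a | Q? a
  ... | yes pa | _      = ⊥-elim (¬pw pa)
  ... | no _   | yes _  = s≤s (filter-length-mono l)
  ... | no _   | no ¬qa = ⊥-elim (¬qa qw)
  filter-length-strict (a ∷ l) (there w∈) qw ¬pw with P? a | Q? a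
  ... | yes _  | yes _  = s≤s (filter-length-strict l w∈ qw ¬pw)
  ... | yes pa | no ¬qa = ⊥-elim (¬qa (P⇒Q pa))
  ... | no _   | yes _  = m≤n⇒m≤1+n (filter-length-strict l w∈ qw ¬pw)
  ... | no _   | no _   = filter-length-strict l w∈ qw ¬pw

countAbove-anti : ∀ w {u v} → u ≤ v → countAbove w v ≤ countAbove w u
countAbove-anti w u≤v = filter-length-mono _ _ (≤-<-trans u≤v) w

countAbove-anti-strict : ∀ w {u v} → u < v → v ∈ w → countAbove w v < countAbove w u
countAbove-anti-strict w u<v v∈ = filter-length-strict _ _ (<-trans u<v) w v∈ u<v (<-irrefl refl)

countBelow-strict : ∀ w {x y} → x < y → x ∈ w → countBelow w x < countBelow w y
countBelow-strict w x<y x∈ = filter-length-strict _ _ (λ z<x → <-trans z<x x<y) w x∈ x<y (<-irrefl refl)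

countBelow-< : ∀ w {x} → x ∈ w → countBelow w x < length w
countBelow-< w {x} x∈ = subst (countBelow w x <_) (cong length (filter-all (λ _ → yes tt) (All.universal _ w)))
  (filter-length-strict (_<? x) (λ _ → yes tt) _ w x∈ tt (<-irrefl refl))

countAbove-∷-< : ∀ a w {y} → y < a → countAbove (a ∷ w) y ≡ suc (countAbove w y)
countAbove-∷-< a w y<a = cong length (filter-accept (_ <?_) y<a)

countAbove-∷-≮ : ∀ a w {y} → ¬ y < a → countAbove (a ∷ w) y ≡ countAbove w y
countAbove-∷-≮ a w y≮a = cong length (filter-reject (_ <?_) y≮a)

rank-attained : ∀ w → Unique w → ∀ r → r < length w → Σ ℕ λ y → y ∈ w × countAbove w y ≡ r
rank-attained (a ∷ w) (a∉w ∷ uw) r r< with <-cmp r (countAbove w a)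
... | tri≈ _ r≡ _ = a , here refl , trans (countAbove-∷-≮ a w (<-irrefl refl)) (sym r≡)
... | tri< r<ra _ _ =
  -- the entry of rank r in w lies above a, so a does not change its rank
  let y , y∈ , ry = rank-attained w uw r (<-≤-trans r<ra (length-filter _ w)) in
  y , there y∈ , trans (countAbove-∷-≮ a w (λ y<a → <⇒≱ r<ra (subst (countAbove w a ≤_) ry (countAbove-anti w (<⇒≤ y<a))))) ry
... | tri> _ _ ra<r with r | r<
...   | suc r′ | s≤s r′< =
  -- the entry of rank r′ in w lies below a, so a adds one to its rank
  let y , y∈ , ry = rank-attained w uw r′ r′< in
  y , there y∈ , trans (countAbove-∷-< a w (below y y∈ ry)) (cong suc ry)
  where
  below : ∀ y → y ∈ w → countAbove w y ≡ r′ → y < a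
  below y y∈ ry with <-cmp y a
  ... | tri< y<a _ _ = y<a
  ... | tri≈ _ refl _ = ⊥-elim (All.lookup a∉w y∈ refl)
  ... | tri> _ _ a<y = ⊥-elim (<⇒≱ (subst (_< countAbove w a) ry (countAbove-anti-strict w a<y y∈)) (≤-pred ra<r))

headOr-filter : ∀ {Q : ℕ → Set} (Q? : ∀ x → Dec (Q x)) d w {y} → y ∈ w → Q y →
  headOr d (filter Q? w) ∈ w × Q (headOr d (filter Q? w))
headOr-filter Q? d (a ∷ w) y∈ qy with Q? a
... | yes qa = here refl , qa
headOr-filter Q? d (a ∷ w) (here refl) qy | no ¬qa = ⊥-elim (¬qa qy)
headOr-filter Q? d (a ∷ w) (there y∈) qy | no ¬qa =
  let h∈ , qh = headOr-filter Q? d w y∈ qy in there h∈ , qh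

module Switch (w : List ℕ) (uw : Unique w) where

  f : ℕ → ℕ
  f = switchEntry w

  switchEntry-rank : ∀ {x} → x ∈ w → f x ∈ w × countAbove w (f x) ≡ countBelow w x
  switchEntry-rank {x} x∈ =
    let y , y∈ , ry = rank-attained w uw (countBelow w x) (countBelow-< w x∈) in
    headOr-filter (λ y → countAbove w y ≟ countBelow w x) x w y∈ ry

  switchEntry-∈ : ∀ {x} → x ∈ w → f x ∈ w
  switchEntry-∈ = proj₁ ∘ switchEntry-rank

  switchEntry-reverses : ∀ {x y} → x ∈ w → y ∈ w → x < y → f y < f x
  switchEntry-reverses {x} {y} x∈ y∈ x<y = ≰⇒> λ fx≤fy → <⇒≱ ranks< (begin
    countAbove w (f y)  ≤⟨ countAbove-anti w fx≤fy ⟩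
    countAbove w (f x)  ≡⟨ proj₂ (switchEntry-rank x∈) ⟩
    countBelow w x      ∎)
    where
    open ≤-Reasoning
    ranks< : countBelow w x < countAbove w (f y)
    ranks< = subst (countBelow w x <_) (sym (proj₂ (switchEntry-rank y∈))) (countBelow-strict w x<y x∈)

  switchEntry-<-⇔ : ∀ {x y} → x ∈ w → y ∈ w → f y < f x ⇔ x < y
  switchEntry-<-⇔ {x} {y} x∈ y∈ = mk⇔ from (switchEntry-reverses x∈ y∈)
    where
    from : f y < f x → x < y
    from fy<fx with <-cmp x y
    ... | tri< x<y _ _ = x<y
    ... | tri≈ _ refl _ = ⊥-elim (<-irrefl refl fy<fx)
    ... | tri> _ _ y<x = ⊥-elim (<-asym fy<fx (switchEntry-reverses y∈ x∈ y<x))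

  switchEntry-injective : ∀ {x y} → x ∈ w → y ∈ w → f x ≡ f y → x ≡ y
  switchEntry-injective {x} {y} x∈ y∈ fx≡fy with <-cmp x y
  ... | tri< x<y _ _ = ⊥-elim (<-irrefl (sym fx≡fy) (switchEntry-reverses x∈ y∈ x<y))
  ... | tri≈ _ x≡y _ = x≡y
  ... | tri> _ _ y<x = ⊥-elim (<-irrefl fx≡fy (switchEntry-reverses y∈ x∈ y<x))

map-unique-on : ∀ (g : ℕ → ℕ) (l : List ℕ) → (∀ {x y} → x ∈ l → y ∈ l → g x ≡ g y → x ≡ y) →
  Unique l → Unique (map g l)
map-unique-on g [] _ [] = []
map-unique-on g (a ∷ l) inj (a∉l ∷ ul) =
  All.map⁺ (All.tabulate λ y∈ ga≡gy → All.lookup a∉l y∈ (inj (here refl) (there y∈) ga≡gy))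
  ∷ map-unique-on g l (λ x∈ y∈ → inj (there x∈) (there y∈)) ul

unique-⊆-↭ : ∀ (A B : List ℕ) → Unique A → Unique B → All (_∈ B) A → length A ≡ length B → A ↭ B
unique-⊆-↭ [] [] _ _ _ _ = ↭-refl
unique-⊆-↭ (a ∷ A) B (a∉A ∷ uA) uB (a∈B ∷ A⊆B) |A|≡|B| with ∈-∃++ a∈B
... | B₁ , B₂ , refl =
  ↭-trans (prep a (unique-⊆-↭ A (B₁ ++ B₂) uA uB′ A⊆B′ |A|≡|B′|)) (↭-sym (shift a B₁ B₂))
  where
  uB′ : Unique (B₁ ++ B₂)
  uB′ with unique-resp-↭ (shift a B₁ B₂) uB
  ... | _ ∷ u = u
  A⊆B′ : All (_∈ B₁ ++ B₂) A
  A⊆B′ = All.zipWith (λ (a≢z , z∈B) → drop-a a≢z (∈-++⁻ B₁ z∈B)) (a∉A , A⊆B)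
    where
    drop-a : ∀ {z} → a ≢ z → z ∈ B₁ ⊎ z ∈ a ∷ B₂ → z ∈ B₁ ++ B₂
    drop-a _ (inj₁ z∈) = ∈-++⁺ˡ z∈
    drop-a a≢z (inj₂ (here refl)) = ⊥-elim (a≢z refl)
    drop-a _ (inj₂ (there z∈)) = ∈-++⁺ʳ B₁ z∈
  |A|≡|B′| : length A ≡ length (B₁ ++ B₂)
  |A|≡|B′| = suc-injective (begin
    suc (length A)             ≡⟨ |A|≡|B| ⟩
    length (B₁ ++ a ∷ B₂)      ≡⟨ length-++ B₁ ⟩
    length B₁ + suc (length B₂) ≡⟨ +-suc (length B₁) (length B₂) ⟩
    suc (length B₁ + length B₂) ≡⟨ cong suc (length-++ B₁) ⟨
    suc (length (B₁ ++ B₂))    ∎)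
    where open ≡-Reasoning

switch-unique : ∀ w → Unique w → Unique (switch w)
switch-unique w uw = map-unique-on (switchEntry w) w switchEntry-injective uw
  where open Switch w uw

switch-↭ : ∀ w → Unique w → switch w ↭ w
switch-↭ w uw = unique-⊆-↭ (switch w) w (switch-unique w uw) uw
  (All.map⁺ (All.tabulate switchEntry-∈)) (length-map (switchEntry w) w)
  where open Switch w uw

classify : Bool → Bool → ℕ → List (ℕ × Bool) → List (ℕ × Bool)
classify isMin isMax i l = if isMin then (i , false) ∷ l else if isMax then (i , true) ∷ l else l

flipTag : ℕ × Bool → ℕ × Bool
flipTag (i , b) = i , not b

classify-flip : ∀ isMin isMax i l → (isMin ≡ true → isMax ≡ true → ⊥) →
  classify isMax isMin i (map flipTag l) ≡ map flipTag (classify isMin isMax i l)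
classify-flip true true i l notBoth = ⊥-elim (notBoth refl refl)
classify-flip true false i l _ = refl
classify-flip false true i l _ = refl
classify-flip false false i l _ = refl

isLRMin-true⇒ : ∀ {pre x} → isLRMin pre x ≡ true → All (x <_) pre
isLRMin-true⇒ {pre} {x} = isYes⇒ (All.all? (x <?_) pre)

isLRMax-true⇒ : ∀ {pre x} → isLRMax pre x ≡ true → All (_< x) pre
isLRMax-true⇒ {pre} {x} = isYes⇒ (All.all? (_<? x) pre)

isLRMin-false⇒ : ∀ {pre x} → isLRMin pre x ≡ false → ¬ All (x <_) pre
isLRMin-false⇒ {pre} {x} = isYes-false⇒¬ (All.all? (x <?_) pre)

isLRMax-false⇒ : ∀ {pre x} → isLRMax pre x ≡ false → ¬ All (_< x) pre
isLRMax-false⇒ {pre} {x} = isYes-false⇒¬ (All.all? (_<? x) pre)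

not-both-extreme : ∀ p ps x → isLRMin (p ∷ ps) x ≡ true → isLRMax (p ∷ ps) x ≡ true → ⊥
not-both-extreme p ps x isMin isMax with isLRMin-true⇒ isMin | isLRMax-true⇒ isMax
... | x<p ∷ _ | p<x ∷ _ = <-asym x<p p<x

module _ (w : List ℕ) (uw : Unique w) where
  open Switch w uw

  isLRMin-switch : ∀ pre {x} → All (_∈ w) pre → x ∈ w → isLRMin (map f pre) (f x) ≡ isLRMax pre x
  isLRMin-switch pre pre⊆w x∈ = isYes-⇔ (mk⇔ to from) (All.all? _ _) (All.all? _ _)
    where
    to : All (f _ <_) (map f pre) → All (_< _) pre
    to fx<fpre = All.zipWith (λ (fx<fy , y∈) → Equivalence.to (switchEntry-<-⇔ y∈ x∈) fx<fy) (All.map⁻ fx<fpre , pre⊆w)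
    from : All (_< _) pre → All (f _ <_) (map f pre)
    from pre<x = All.map⁺ (All.zipWith (λ (y<x , y∈) → switchEntry-reverses y∈ x∈ y<x) (pre<x , pre⊆w))

  isLRMax-switch : ∀ pre {x} → All (_∈ w) pre → x ∈ w → isLRMax (map f pre) (f x) ≡ isLRMin pre x
  isLRMax-switch pre {x} pre⊆w x∈ = isYes-⇔ (mk⇔ to from) (All.all? _ _) (All.all? _ _)
    where
    to : All (_< f x) (map f pre) → All (x <_) pre
    to fpre<fx = All.zipWith (λ (fy<fx , y∈) → Equivalence.to (switchEntry-<-⇔ x∈ y∈) fy<fx) (All.map⁻ fpre<fx , pre⊆w)
    from : All (x <_) pre → All (_< f x) (map f pre)
    from x<pre = All.map⁺ (All.zipWith (λ (x<y , y∈) → switchEntry-reverses x∈ y∈ x<y) (x<pre , pre⊆w))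

  extremesGo-switch : ∀ i p ps xs → All (_∈ w) (p ∷ ps) → All (_∈ w) xs →
    extremesGo i (map f (p ∷ ps)) (map f xs) ≡ map flipTag (extremesGo i (p ∷ ps) xs)
  extremesGo-switch i p ps [] _ _ = refl
  extremesGo-switch i p ps (x ∷ xs) pre⊆w (x∈ ∷ xs⊆w) = begin
    classify (isLRMin (map f pre) (f x)) (isLRMax (map f pre) (f x)) i
      (extremesGo (suc i) (map f pre ++ [ f x ]) (map f xs))
      ≡⟨ cong₂ (λ isMin isMax → classify isMin isMax i (extremesGo (suc i) (map f pre ++ [ f x ]) (map f xs)))
           (isLRMin-switch pre pre⊆w x∈) (isLRMax-switch pre pre⊆w x∈) ⟩
    classify (isLRMax pre x) (isLRMin pre x) i (extremesGo (suc i) (map f pre ++ [ f x ]) (map f xs))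
      ≡⟨ cong (classify (isLRMax pre x) (isLRMin pre x) i) rest ⟩
    classify (isLRMax pre x) (isLRMin pre x) i (map flipTag (extremesGo (suc i) (pre ++ [ x ]) xs))
      ≡⟨ classify-flip (isLRMin pre x) (isLRMax pre x) i _ (not-both-extreme p ps x) ⟩
    map flipTag (extremesGo i pre (x ∷ xs)) ∎
    where
    open ≡-Reasoning
    pre : List ℕ
    pre = p ∷ ps
    rest : extremesGo (suc i) (map f pre ++ [ f x ]) (map f xs) ≡ map flipTag (extremesGo (suc i) (pre ++ [ x ]) xs)
    rest = trans (cong (λ q → extremesGo (suc i) q (map f xs)) (sym (map-++ f pre [ x ])))
                 (extremesGo-switch (suc i) p (ps ++ [ x ]) xs (All.++⁺ pre⊆w (x∈ ∷ [])) xs⊆w)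

switch-extremes : ∀ w → Unique w → extremes (switch w) ≡ map flipTag (extremes w)
switch-extremes [] _ = refl
switch-extremes (x ∷ xs) uw = extremesGo-switch (x ∷ xs) uw 1 x [] xs (here refl ∷ []) (All.tabulate there)

classify-++ : ∀ isMin isMax i l r → classify isMin isMax i (l ++ r) ≡ classify isMin isMax i l ++ r
classify-++ true _ i l r = refl
classify-++ false true i l r = refl
classify-++ false false i l r = refl

classify-[] : ∀ isMin isMax i l → classify isMin isMax i l ≡ [] → isMin ≡ false × isMax ≡ false × l ≡ []
classify-[] true _ i l ()
classify-[] false true i l ()
classify-[] false false i l l≡[] = refl , refl , l≡[]

classify-single : ∀ isMin isMax i {j b} → lastMaybe (classify isMin isMax i []) ≡ just (j , b) →
  j ≡ i × (b ≡ false → isMin ≡ true) × classify isMin isMax i [] ≡ [ (j , b) ]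
classify-single true _ i refl = refl , (λ _ → refl) , refl
classify-single false true i refl = refl , (λ ()) , refl
classify-single false false i ()

lastMaybe-nothing : ∀ {A : Set} (l : List A) → lastMaybe l ≡ nothing → l ≡ []
lastMaybe-nothing [] _ = refl
lastMaybe-nothing (x ∷ []) ()
lastMaybe-nothing (x ∷ y ∷ l) none with () ← lastMaybe-nothing (y ∷ l) none

lastMaybe-∷ : ∀ {A : Set} (e : A) l {t} → lastMaybe l ≡ just t → lastMaybe (e ∷ l) ≡ just t
lastMaybe-∷ e (y ∷ l) last = last

lastMaybe-classify : ∀ isMin isMax i l {t} → lastMaybe l ≡ just t → lastMaybe (classify isMin isMax i l) ≡ just t
lastMaybe-classify true _ i l = lastMaybe-∷ _ l
lastMaybe-classify false true i l = lastMaybe-∷ _ l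
lastMaybe-classify false false i l last = last

lastMaybe-map : ∀ {A B : Set} (g : A → B) l → lastMaybe (map g l) ≡ Maybe.map g (lastMaybe l)
lastMaybe-map g [] = refl
lastMaybe-map g (x ∷ []) = refl
lastMaybe-map g (x ∷ y ∷ l) = lastMaybe-map g (y ∷ l)

-- If no entry of xs is extreme after the prefix pre, every entry of xs is bounded by any
-- upper bound of pre: each entry, not being an LR maximum, lies below an earlier entry.
no-extremes-bounded : ∀ i pre xs {m} → extremesGo i pre xs ≡ [] → All (_≤ m) pre → All (_≤ m) xs
no-extremes-bounded i pre [] _ _ = []
no-extremes-bounded i pre (x ∷ xs) {m} none pre≤m
  with _ , notMax , rest ← classify-[] (isLRMin pre x) (isLRMax pre x) i _ none =
  x≤m ∷ no-extremes-bounded (suc i) (pre ++ [ x ]) xs rest (All.++⁺ pre≤m (x≤m ∷ []))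
  where
  x≤m : x ≤ m
  x≤m = All.lookupWith (λ y≤m y≮x → ≤-trans (≮⇒≥ y≮x) y≤m) pre≤m
          (All.¬All⇒Any¬ (_<? x) pre (isLRMax-false⇒ notMax))

record LastExtreme (i : ℕ) (pre xs : List ℕ) (j : ℕ) (b : Bool) : Set where
  field
    before after : List ℕ
    entry : ℕ
    split : xs ≡ before ++ entry ∷ after
    position : j ≡ i + length before
    extremes-split : extremesGo i pre xs ≡ extremesGo i pre before ++ [ (j , b) ]
    bounded : b ≡ false → ∀ {m} → All (_≤ m) (pre ++ before) → All (_≤ m) (entry ∷ after)

lastExtreme : ∀ i p ps xs {j b} → lastMaybe (extremesGo i (p ∷ ps) xs) ≡ just (j , b) →
  LastExtreme i (p ∷ ps) xs j b
lastExtreme i p ps (x ∷ xs) {j} {b} last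
  with lastMaybe (extremesGo (suc i) (p ∷ ps ++ [ x ]) xs) in lastRest
... | nothing
  -- x itself is the last extreme: nothing after it is extreme
  with rest≡[] ← lastMaybe-nothing _ lastRest
  with j≡i , minIfFalse , single ← classify-single (isLRMin (p ∷ ps) x) (isLRMax (p ∷ ps) x) i
         (subst (λ l → lastMaybe (classify (isLRMin (p ∷ ps) x) (isLRMax (p ∷ ps) x) i l) ≡ just (j , b)) rest≡[] last)
  = record
  { before = [] ; after = xs ; entry = x ; split = refl
  ; position = trans j≡i (sym (+-identityʳ i))
  ; extremes-split = trans (cong (classify (isLRMin (p ∷ ps) x) (isLRMax (p ∷ ps) x) i) rest≡[]) single
  ; bounded = bounded }
  where
  bounded : b ≡ false → ∀ {m} → All (_≤ m) (p ∷ ps ++ []) → All (_≤ m) (x ∷ xs)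
  bounded b≡false {m} pre≤m =
    x≤m ∷ no-extremes-bounded (suc i) (p ∷ ps ++ [ x ]) xs rest≡[] (All.++⁺ pre≤m′ (x≤m ∷ []))
    where
    pre≤m′ : All (_≤ m) (p ∷ ps)
    pre≤m′ = subst (All (_≤ m)) (++-identityʳ (p ∷ ps)) pre≤m
    -- x is an LR minimum, so it lies below p
    x≤m : x ≤ m
    x≤m with x<p ∷ _ ← isLRMin-true⇒ (minIfFalse b≡false) | p≤m ∷ _ ← pre≤m′ = <⇒≤ (<-≤-trans x<p p≤m)
... | just t
  -- the last extreme lies further right: extend the decomposition of xs by x
  with trans (sym (lastMaybe-classify (isLRMin (p ∷ ps) x) (isLRMax (p ∷ ps) x) i _ lastRest)) last
...   | refl = record
  { before = x ∷ before ; after = after ; entry = entry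
  ; split = cong (x ∷_) split
  ; position = trans position (sym (+-suc i (length before)))
  ; extremes-split = trans (cong (classify (isLRMin (p ∷ ps) x) (isLRMax (p ∷ ps) x) i) extremes-split)
                           (classify-++ (isLRMin (p ∷ ps) x) (isLRMax (p ∷ ps) x) i _ _)
  ; bounded = λ b≡false {m} → bounded b≡false ∘ subst (All (_≤ m)) (sym (++-assoc (p ∷ ps) [ x ] before)) }
  where open LastExtreme (lastExtreme (suc i) p (ps ++ [ x ]) xs lastRest)

record PsiInvariant (cs : List (List ℕ)) (τ : List ℕ) : Set where
  field
    leftover : ℕ
    partition : concat cs ++ [ leftover ] ↭ τ
    leftover-bound : All (_≤ leftover) τ
    nonEmpty : All (_≢ []) cs
    cycleCount : length cs ≡ extr τ

invariant-resp-↭ : ∀ {cs τ′ τ} → τ′ ↭ τ → extr τ′ ≡ extr τ → PsiInvariant cs τ′ → PsiInvariant cs τ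
invariant-resp-↭ τ′↭τ sameExtr inv = record
  { leftover = leftover ; partition = ↭-trans partition τ′↭τ
  ; leftover-bound = All-resp-↭ τ′↭τ leftover-bound ; nonEmpty = nonEmpty
  ; cycleCount = trans cycleCount sameExtr }
  where open PsiInvariant inv

take-length-++ : ∀ (xs : List ℕ) ys → take (length xs) (xs ++ ys) ≡ xs
take-length-++ [] ys = refl
take-length-++ (x ∷ xs) ys = cong (x ∷_) (take-length-++ xs ys)

drop-length-++ : ∀ (xs : List ℕ) ys → drop (length xs) (xs ++ ys) ≡ ys
drop-length-++ [] ys = refl
drop-length-++ (x ∷ xs) ys = drop-length-++ xs ys

invariant-cut : ∀ τ {j cs} → lastMaybe (extremes τ) ≡ just (j , false) →
  (take j τ ≢ [] → length (take j τ) < length τ → PsiInvariant cs (take j τ)) →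
  PsiInvariant (drop j τ ∷ cs) τ
invariant-cut (x ∷ xs) {cs = cs} last prefixInvariant
  with lastExtreme 1 x [] xs last
... | record { before = before ; after = after ; entry = z ; split = refl ; position = refl
             ; extremes-split = extremes-split ; bounded = bounded }
  rewrite take-length-++ before (z ∷ after) | drop-length-++ before (z ∷ after) = record
  { leftover = leftover
  ; partition = partition′
  ; leftover-bound = All.++⁺ leftover-bound (bounded refl leftover-bound)
  ; nonEmpty = (λ ()) ∷ nonEmpty
  ; cycleCount = cycleCount′ }
  where
  open PsiInvariant (prefixInvariant (λ ()) (s≤s (<-length-++-∷ before after)))
  partition′ : ((z ∷ after) ++ concat cs) ++ [ leftover ] ↭ x ∷ before ++ z ∷ after
  partition′ = begin
    ((z ∷ after) ++ concat cs) ++ [ leftover ]  ≡⟨ ++-assoc (z ∷ after) (concat cs) [ leftover ] ⟩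
    (z ∷ after) ++ concat cs ++ [ leftover ]    ↭⟨ ++⁺ˡ (z ∷ after) partition ⟩
    (z ∷ after) ++ x ∷ before                   ↭⟨ ++-comm (z ∷ after) (x ∷ before) ⟩
    x ∷ before ++ z ∷ after                     ∎
    where open PermutationReasoning
  cycleCount′ : suc (length cs) ≡ extr (x ∷ before ++ z ∷ after)
  cycleCount′ = begin
    suc (length cs)                  ≡⟨ cong suc cycleCount ⟩
    suc (extr (x ∷ before))          ≡⟨ +-comm 1 (extr (x ∷ before)) ⟩
    extr (x ∷ before) + 1            ≡⟨ length-++ (extremes (x ∷ before)) ⟨
    length (extremes (x ∷ before) ++ [ (suc (length before) , false) ])  ≡⟨ cong length extremes-split ⟨
    extr (x ∷ before ++ z ∷ after)   ∎
    where open ≡-Reasoning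

second-entry-extreme : ∀ {x y ys} → Unique (x ∷ y ∷ ys) → extremes (x ∷ y ∷ ys) ≢ []
second-entry-extreme {x} {y} ((x≢y ∷ _) ∷ _) none
  with notMin , notMax , _ ← classify-[] (isLRMin [ x ] y) (isLRMax [ x ] y) 1 _ none
  with <-cmp x y
... | tri< x<y _ _ = isLRMax-false⇒ notMax (x<y ∷ [])
... | tri≈ _ x≡y _ = x≢y x≡y
... | tri> _ _ y<x = isLRMin-false⇒ notMin (y<x ∷ [])

psiInvariant : ∀ k τ → Unique τ → length τ ≤ k → τ ≢ [] → PsiInvariant (psiGo k τ) τ
psiInvariant k [] _ _ τ≢[] = ⊥-elim (τ≢[] refl)
psiInvariant zero (x ∷ _) _ () _
psiInvariant (suc k) (x ∷ []) _ _ _ = record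
  { leftover = x ; partition = ↭-refl ; leftover-bound = ≤-refl ∷ [] ; nonEmpty = [] ; cycleCount = refl }
psiInvariant (suc k) τ@(x ∷ y ∷ ys) uτ |τ|≤ _ with lastMaybe (extremes τ) in last
... | nothing = ⊥-elim (second-entry-extreme uτ (lastMaybe-nothing _ last))
... | just (j , false) = invariant-cut τ last λ nonempty shorter →
  psiInvariant k (take j τ) (Unique.take⁺ j uτ) (≤-pred (≤-trans shorter |τ|≤)) nonempty
... | just (j , true) =
  -- switching turns the final LR maximum into an LR minimum and changes neither entries nor extremes
  invariant-resp-↭ (switch-↭ τ uτ) (trans (cong length switched) (length-map flipTag (extremes τ)))
    (invariant-cut (switch τ) last′ λ nonempty shorter →
      psiInvariant k (take j (switch τ)) (Unique.take⁺ j (switch-unique τ uτ))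
        (≤-pred (≤-trans shorter (subst (_≤ suc k) (sym (length-map (switchEntry τ) τ)) |τ|≤))) nonempty)
  where
  switched : extremes (switch τ) ≡ map flipTag (extremes τ)
  switched = switch-extremes τ uτ
  last′ : lastMaybe (extremes (switch τ)) ≡ just (j , false)
  last′ = trans (cong lastMaybe switched) (trans (lastMaybe-map flipTag (extremes τ)) (cong (Maybe.map flipTag) last))

remove-largest : ∀ n L m → L ++ [ m ] ↭ map suc (upTo (suc n)) → All (_≤ m) (map suc (upTo (suc n))) →
  L ↭ map suc (upTo n)
remove-largest n L m L∷m↭ ≤m =
  subst₂ _↭_ (++-identityʳ L) (++-identityʳ (map suc (upTo n))) (drop-mid L (map suc (upTo n)) L∷n↭)
  where
  m≤1+n : m ≤ suc n
  m≤1+n with i , i∈ , refl ← ∈-map⁻ suc (∈-resp-↭ L∷m↭ (∈-++⁺ʳ L (here refl))) = ∈-upTo⁻ i∈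
  m≡1+n : m ≡ suc n
  m≡1+n = ≤-antisym m≤1+n (All.lookup ≤m (∈-map⁺ suc (∈-upTo⁺ ≤-refl)))
  listing : map suc (upTo (suc n)) ≡ map suc (upTo n) ++ [ suc n ]
  listing = trans (cong (map suc) (sym (upTo-∷ʳ n))) (map-++ suc (upTo n) [ n ])
  L∷n↭ : L ++ [ suc n ] ↭ map suc (upTo n) ++ [ suc n ]
  L∷n↭ = subst₂ _↭_ (cong (λ t → L ++ [ t ]) m≡1+n) listing L∷m↭

proposition4p4 : (n : ℕ) (π : List ℕ) → π ↭ map suc (upTo (suc n)) → UpDown π →
    numCycles n (psi π) ≡ extr π
proposition4p4 n π π↭ _ = begin
  numCycles n (applyCycles cs)  ≡⟨ numCycles-applyCycles n cs nonEmpty listsOneToN ⟩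
  length cs                     ≡⟨ cycleCount ⟩
  extr π                        ∎
  where
  open ≡-Reasoning
  cs : List (List ℕ)
  cs = psiCycles π
  uπ : Unique π
  uπ = unique-resp-↭ (↭-sym π↭) (Unique.map⁺ suc-injective (Unique.upTo⁺ (suc n)))
  π≢[] : π ≢ []
  π≢[] π≡[] with () ← trans (cong length (sym π≡[]))
                         (trans (↭-length π↭) (trans (length-map suc (upTo (suc n))) (length-upTo (suc n))))
  open PsiInvariant (psiInvariant (length π) π uπ ≤-refl π≢[])
  listsOneToN : concat cs ↭ map suc (upTo n)
  listsOneToN = remove-largest n (concat cs) leftover (↭-trans partition π↭) (All-resp-↭ π↭ leftover-bound)
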